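{- With probability at least $0.99$ over the randomness of the construction, the total number of levels in the learning-augmented skip list built from predictions $p$ is at most $10+\log n$.
   Context: Logarithms are base $2$. Items $[n]$; predictions $p_i\in[0,1]$, $\sum_i p_i=1$. Construction: insert all items into level $0$; for $\ell=1,2,\ldots$: if level $\ell-1$ is empty, stop; otherwise for each $i$, if $p_i\ge\frac{2^{\ell-1}}{n}$ insert $i$ into level $\ell$, else if $i$ is in level $\ell-1$ insert $i$ into level $\ell$ independently with probability $\frac12$. The number of levels is the number of nonempty levels.
   Formalization: The predictions $p_i$ take rational values in [0,1] rather than real ones. -}

module Defs where

open import Data.Bool using (Bool; true; false; _∧_; _∨_; if_then_else_)
open import Data.Nat as ℕ using (ℕ; zero; suc; _^_)
open import Data.Nat.Logarithm using (⌊log₂_⌋)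
open import Data.Fin using (Fin)
open import Data.Bool.ListAction using (any)
open import Data.List using (List; []; _∷_; map; concatMap; filterᵇ; length; upTo; allFin; foldr)
open import Data.Vec using (Vec; []; _∷_; lookup)
open import Data.Integer using (+_)
open import Data.Rational using (ℚ; _≤_; _+_; _*_; _/_; 0ℚ)
open import Data.Rational.Properties using (_≤?_)
open import Relation.Nullary.Decidable using (⌊_⌋; yes; no)
open import Data.Fin using (fromℕ<)

ℕ→ℚ : ℕ → ℚ
ℕ→ℚ m = (+ m) / 1

sumℚ : {n : ℕ} → (Fin n → ℚ) → ℚ
sumℚ {n} p = foldr (λ i acc → p i + acc) 0ℚ (allFin n)

-- Deterministic insertion test for level ℓ+1 (ℓ+1 ≥ 1):
--   p i ≥ 2^ℓ / n   ⇔   2^ℓ ≤ n · p i   (n ≥ 1 whenever Σ p = 1).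
forced : {n : ℕ} → (Fin n → ℚ) → Fin n → ℕ → Bool
forced {n} p i ℓ = ⌊ ℕ→ℚ (2 ^ ℓ) ≤? (ℕ→ℚ n * p i) ⌋

nonempty : {n : ℕ} → (Fin n → Bool) → Bool
nonempty {n} S = any S (allFin n)

-- The construction.  coins i ℓ is the fair coin used when deciding
-- whether item i (present in level ℓ) is promoted to level ℓ+1.
level : {n : ℕ} → (Fin n → ℚ) → (Fin n → ℕ → Bool) → ℕ → Fin n → Bool
level p coins zero    i = true
level p coins (suc ℓ) i =
  nonempty (level p coins ℓ) ∧ (forced p i ℓ ∨ (level p coins ℓ i ∧ coins i ℓ))

nonemptyLevelsUpTo : {n : ℕ} → (Fin n → ℚ) → (Fin n → ℕ → Bool) → ℕ → ℕ
nonemptyLevelsUpTo p coins H =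
  foldr (λ ℓ acc → (if nonempty (level p coins ℓ) then 1 else 0) ℕ.+ acc) 0 (upTo (suc H))

allVecs : {A : Set} → List A → (k : ℕ) → List (Vec A k)
allVecs xs zero    = [] ∷ []
allVecs xs (suc k) = concatMap (λ x → map (x ∷_) (allVecs xs k)) xs

-- Finite sample space: the coins for levels 0..L-1 of every item
-- (all 2^(n·L) outcomes, each equally likely).
Outcome : ℕ → ℕ → Set
Outcome n L = Vec (Vec Bool L) n

outcomes : (n L : ℕ) → List (Outcome n L)
outcomes n L = allVecs (allVecs (true ∷ false ∷ []) L) n

-- Coins read off an outcome (coins at levels ≥ L never influence levels 0..L).
coinsOf : {n L : ℕ} → Outcome n L → Fin n → ℕ → Bool
coinsOf {n} {L} ω i ℓ with ℓ ℕ.<? L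
... | yes ℓ<L = lookup (lookup ω i) (fromℕ< ℓ<L)
... | no  _   = false

atMostLevels : {n : ℕ} → (Fin n → ℚ) → (L : ℕ) → Outcome n L → Bool
atMostLevels p L ω = ⌊ nonemptyLevelsUpTo p (coinsOf ω) L ℕ.≤? L ⌋

favourable : {n : ℕ} → (Fin n → ℚ) → (L : ℕ) → ℕ
favourable {n} p L = length (filterᵇ (atMostLevels p L) (outcomes n L))

-- The bound 10 + log n, for integer-valued level counts: 10 + ⌊log₂ n⌋.
bound : ℕ → ℕ
bound n = 10 ℕ.+ ⌊log₂ n ⌋

module Submission where

-- Let g i be the least level with 2 ^ g i > n · p i. From level g i on, item i is never
-- promoted deterministically, so it reaches level L only if its coin flips at levels
-- g i, …, L - 1 all come up true, which happens in at most a 2 ^ g i / 2 ^ L fraction of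
-- the outcomes. By minimality 2 ^ g i ≤ 2 n p i + 1, so by the union bound level L is
-- nonempty in at most a 3 n / 2 ^ L ≤ 1 / 100 fraction of the outcomes, and whenever
-- level L is empty at most L levels are nonempty.

open import Defs
open import Data.Nat using (ℕ; _*_; _≤_)
open import Data.Fin using (Fin)
open import Data.List using (length)
open import Data.Product using (_×_)
open import Data.Rational using (ℚ; 0ℚ; 1ℚ) renaming (_≤_ to _≤ℚ_)
open import Relation.Binary.PropositionalEquality using (_≡_)

import Algebra.Properties.CommutativeSemigroup as CommutativeSemigroup
open import Data.Bool using (Bool; true; false; T; T?; not; _∧_; _∨_; if_then_else_)
open import Data.Bool.ListAction using (any)
open import Data.Bool.Properties using (T-∧)
open import Data.Fin using (zero; suc; fromℕ<)
open import Data.Integer as ℤ using (+≤+)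
import Data.Integer.Properties as ℤ
open import Data.List using (List; []; _∷_; _++_; _∷ʳ_; map; concatMap; filterᵇ; foldr; upTo; allFin)
open import Data.List.Properties using (length-upTo; upTo-∷ʳ; length-tabulate)
open import Data.Maybe using (nothing)
open import Data.Nat using (zero; suc; _+_; _^_; _<_; _<?_; _≤?_; z≤n; s≤s; s≤s⁻¹)
open import Data.Nat.Coprimality using (1-coprimeTo) renaming (sym to Coprime-sym)
open import Data.Nat.Logarithm using (⌊log₂_⌋; ⌊log₂⌋-mono-≤; ⌊log₂[2^n]⌋≡n)
open import Data.Nat.Properties
open import Data.Nat.Tactic.RingSolver using () renaming (solve-∀ to ℕ-solve-∀)
open import Data.Product using (_,_; ∃-syntax; proj₁; proj₂)
import Data.Rational as ℚ
import Data.Rational.Properties as ℚ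
import Data.Rational.Unnormalised as ℚᵘ
import Data.Rational.Unnormalised.Properties as ℚᵘ
open import Data.Sum using (inj₁; inj₂)
open import Data.Unit using (tt)
open import Data.Vec using (Vec; []; _∷_; lookup)
open import Function using (_∘_; id)
open import Function.Bundles using (Equivalence)
open import Level using (0ℓ)
open import Relation.Binary.PropositionalEquality
  using (refl; sym; trans; cong; cong₂; subst; subst₂; module ≡-Reasoning)
open import Relation.Nullary using (¬_; yes; no; contradiction)
open import Relation.Nullary.Decidable using (decidable-stable; toWitness; toWitnessFalse)
open import Tactic.RingSolver using (solve-∀)
open import Tactic.RingSolver.Core.AlmostCommutativeRing using (AlmostCommutativeRing; fromCommutativeRing)

open CommutativeSemigroup +-commutativeSemigroup using (interchange)
module *-CS = CommutativeSemigroup *-commutativeSemigroup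

-- The fold of nonemptyLevelsUpTo, so that it unfolds to a ∑ definitionally.
∑ : {A : Set} → List A → (A → ℕ) → ℕ
∑ xs f = foldr (λ x acc → f x + acc) 0 xs

infix 5 ∑
syntax ∑ xs (λ x → e) = ∑[ x ∈ xs ] e

𝟙 : Bool → ℕ
𝟙 b = if b then 1 else 0

𝟙-mono : ∀ {a b} → (T a → T b) → 𝟙 a ≤ 𝟙 b
𝟙-mono {false}         _   = z≤n
𝟙-mono {true}  {true}  _   = ≤-refl
𝟙-mono {true}  {false} a⇒b with () ← a⇒b tt

𝟙≤1 : ∀ b → 𝟙 b ≤ 1
𝟙≤1 false = z≤n
𝟙≤1 true  = ≤-refl

𝟙-∨ : ∀ a b → 𝟙 (a ∨ b) ≤ 𝟙 a + 𝟙 b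
𝟙-∨ false b = ≤-refl
𝟙-∨ true  b = s≤s z≤n

module _ {A : Set} where

  ∑-cong : ∀ {f g : A → ℕ} → (∀ x → f x ≡ g x) → ∀ xs → ∑ xs f ≡ ∑ xs g
  ∑-cong f≡g []       = refl
  ∑-cong f≡g (x ∷ xs) = cong₂ _+_ (f≡g x) (∑-cong f≡g xs)

  ∑-mono-≤ : ∀ {f g : A → ℕ} → (∀ x → f x ≤ g x) → ∀ xs → ∑ xs f ≤ ∑ xs g
  ∑-mono-≤ f≤g []       = z≤n
  ∑-mono-≤ f≤g (x ∷ xs) = +-mono-≤ (f≤g x) (∑-mono-≤ f≤g xs)

  ∑-++ : ∀ (f : A → ℕ) xs ys → ∑ (xs ++ ys) f ≡ ∑ xs f + ∑ ys f
  ∑-++ f []       ys = refl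
  ∑-++ f (x ∷ xs) ys = trans (cong (f x +_) (∑-++ f xs ys)) (sym (+-assoc (f x) _ _))

  ∑-const : ∀ c (xs : List A) → ∑[ x ∈ xs ] c ≡ length xs * c
  ∑-const c []       = refl
  ∑-const c (x ∷ xs) = cong (c +_) (∑-const c xs)

  ∑-*ˡ : ∀ c (f : A → ℕ) xs → ∑[ x ∈ xs ] c * f x ≡ c * ∑ xs f
  ∑-*ˡ c f []       = sym (*-zeroʳ c)
  ∑-*ˡ c f (x ∷ xs) = trans (cong (c * f x +_) (∑-*ˡ c f xs)) (sym (*-distribˡ-+ c (f x) _))

  ∑-+ : ∀ (f g : A → ℕ) xs → ∑[ x ∈ xs ] (f x + g x) ≡ ∑ xs f + ∑ xs g
  ∑-+ f g []       = refl
  ∑-+ f g (x ∷ xs) = trans (cong (f x + g x +_) (∑-+ f g xs)) (interchange (f x) (g x) _ _)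

  ∑-zero : ∀ (xs : List A) → ∑[ x ∈ xs ] 0 ≡ 0
  ∑-zero xs = trans (∑-const 0 xs) (*-zeroʳ (length xs))

  length≡∑1 : ∀ (xs : List A) → length xs ≡ ∑[ x ∈ xs ] 1
  length≡∑1 xs = sym (trans (∑-const 1 xs) (*-identityʳ (length xs)))

  ∑𝟙≤length : ∀ (P : A → Bool) xs → ∑[ x ∈ xs ] 𝟙 (P x) ≤ length xs
  ∑𝟙≤length P []       = z≤n
  ∑𝟙≤length P (x ∷ xs) = +-mono-≤ (𝟙≤1 (P x)) (∑𝟙≤length P xs)

  length-filterᵇ+∑𝟙-not : ∀ (P : A → Bool) xs →
    length (filterᵇ P xs) + (∑[ x ∈ xs ] 𝟙 (not (P x))) ≡ length xs
  length-filterᵇ+∑𝟙-not P []       = refl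
  length-filterᵇ+∑𝟙-not P (x ∷ xs) with P x
  ... | true  = cong suc (length-filterᵇ+∑𝟙-not P xs)
  ... | false = trans (+-suc _ _) (cong suc (length-filterᵇ+∑𝟙-not P xs))

module _ {A B : Set} where

  ∑-concatMap : ∀ (f : B → ℕ) (F : A → List B) xs →
    ∑ (concatMap F xs) f ≡ ∑[ x ∈ xs ] ∑ (F x) f
  ∑-concatMap f F []       = refl
  ∑-concatMap f F (x ∷ xs) = trans (∑-++ f (F x) _) (cong (∑ (F x) f +_) (∑-concatMap f F xs))

  ∑-map : ∀ (f : B → ℕ) (g : A → B) xs → ∑ (map g xs) f ≡ ∑ xs (f ∘ g)
  ∑-map f g []       = refl
  ∑-map f g (x ∷ xs) = cong (f (g x) +_) (∑-map f g xs)

  union-bound : ∀ (R : A → B → Bool) ys xs →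
    ∑[ x ∈ xs ] 𝟙 (any (R x) ys) ≤ ∑[ y ∈ ys ] ∑[ x ∈ xs ] 𝟙 (R x y)
  union-bound R []       xs = ≤-reflexive (∑-zero xs)
  union-bound R (y ∷ ys) xs = begin
    ∑[ x ∈ xs ] 𝟙 (R x y ∨ any (R x) ys)
      ≤⟨ ∑-mono-≤ (λ x → 𝟙-∨ (R x y) _) xs ⟩
    ∑[ x ∈ xs ] (𝟙 (R x y) + 𝟙 (any (R x) ys))
      ≡⟨ ∑-+ (λ x → 𝟙 (R x y)) _ xs ⟩
    (∑[ x ∈ xs ] 𝟙 (R x y)) + (∑[ x ∈ xs ] 𝟙 (any (R x) ys))
      ≤⟨ +-monoʳ-≤ _ (union-bound R ys xs) ⟩
    (∑[ x ∈ xs ] 𝟙 (R x y)) + (∑[ y ∈ ys ] ∑[ x ∈ xs ] 𝟙 (R x y))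
      ∎
    where open ≤-Reasoning

module _ {A : Set} (xs : List A) where

  ∑-allVecs-suc : ∀ k (f : Vec A (suc k) → ℕ) →
    ∑ (allVecs xs (suc k)) f ≡ ∑[ x ∈ xs ] ∑[ v ∈ allVecs xs k ] f (x ∷ v)
  ∑-allVecs-suc k f = trans (∑-concatMap f _ xs) (∑-cong (λ x → ∑-map f (x ∷_) (allVecs xs k)) xs)

  length-allVecs : ∀ k → length (allVecs xs k) ≡ length xs ^ k
  length-allVecs zero    = refl
  length-allVecs (suc k) = begin
    length (allVecs xs (suc k))                ≡⟨ length≡∑1 (allVecs xs (suc k)) ⟩
    ∑[ v ∈ allVecs xs (suc k) ] 1              ≡⟨ ∑-allVecs-suc k _ ⟩
    ∑[ x ∈ xs ] ∑[ v ∈ allVecs xs k ] 1        ≡⟨ ∑-cong (λ _ → length≡∑1 (allVecs xs k)) xs ⟨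
    ∑[ x ∈ xs ] length (allVecs xs k)          ≡⟨ ∑-const _ xs ⟩
    length xs * length (allVecs xs k)          ≡⟨ cong (length xs *_) (length-allVecs k) ⟩
    length xs ^ suc k                          ∎
    where open ≡-Reasoning

  ∑-allVecs-lookup : ∀ k (i : Fin (suc k)) (h : A → ℕ) →
    ∑[ v ∈ allVecs xs (suc k) ] h (lookup v i) ≡ length xs ^ k * ∑ xs h
  ∑-allVecs-lookup k zero h = begin
    ∑[ v ∈ allVecs xs (suc k) ] h (lookup v zero)  ≡⟨ ∑-allVecs-suc k _ ⟩
    ∑[ x ∈ xs ] ∑[ v ∈ allVecs xs k ] h x          ≡⟨ ∑-cong (λ x → ∑-const (h x) (allVecs xs k)) xs ⟩
    ∑[ x ∈ xs ] length (allVecs xs k) * h x        ≡⟨ ∑-*ˡ (length (allVecs xs k)) h xs ⟩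
    length (allVecs xs k) * ∑ xs h                 ≡⟨ cong (_* ∑ xs h) (length-allVecs k) ⟩
    length xs ^ k * ∑ xs h                         ∎
    where open ≡-Reasoning
  ∑-allVecs-lookup (suc k) (suc i) h = begin
    ∑[ v ∈ allVecs xs (suc (suc k)) ] h (lookup v (suc i))  ≡⟨ ∑-allVecs-suc (suc k) _ ⟩
    ∑[ x ∈ xs ] ∑[ v ∈ allVecs xs (suc k) ] h (lookup v i)  ≡⟨ ∑-cong (λ _ → ∑-allVecs-lookup k i h) xs ⟩
    ∑[ x ∈ xs ] length xs ^ k * ∑ xs h                      ≡⟨ ∑-const _ xs ⟩
    length xs * (length xs ^ k * ∑ xs h)                    ≡⟨ *-assoc (length xs) _ _ ⟨
    length xs ^ suc k * ∑ xs h                              ∎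
    where open ≡-Reasoning

coinFlips : (L : ℕ) → List (Vec Bool L)
coinFlips = allVecs (true ∷ false ∷ [])

allTrueFrom : ∀ {L} → ℕ → Vec Bool L → Bool
allTrueFrom g       []      = true
allTrueFrom zero    (b ∷ v) = b ∧ allTrueFrom zero v
allTrueFrom (suc g) (_ ∷ v) = allTrueFrom g v

∑𝟙-allTrueFrom≤ : ∀ L g → ∑[ v ∈ coinFlips L ] 𝟙 (allTrueFrom g v) ≤ 2 ^ g
∑𝟙-allTrueFrom≤ zero    g       = m^n>0 2 g
∑𝟙-allTrueFrom≤ (suc L) zero    = begin
  ∑[ v ∈ coinFlips (suc L) ] 𝟙 (allTrueFrom zero v)                ≡⟨ ∑-allVecs-suc _ L _ ⟩
  (∑[ v ∈ coinFlips L ] 𝟙 (allTrueFrom zero v)) + ((∑[ v ∈ coinFlips L ] 0) + 0)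
    ≤⟨ +-mono-≤ (∑𝟙-allTrueFrom≤ L zero) (≤-reflexive (cong (_+ 0) (∑-zero (coinFlips L)))) ⟩
  1                                                                 ∎
  where open ≤-Reasoning
∑𝟙-allTrueFrom≤ (suc L) (suc g) = begin
  ∑[ v ∈ coinFlips (suc L) ] 𝟙 (allTrueFrom (suc g) v)           ≡⟨ ∑-allVecs-suc _ L _ ⟩
  (∑[ v ∈ coinFlips L ] 𝟙 (allTrueFrom g v)) + ((∑[ v ∈ coinFlips L ] 𝟙 (allTrueFrom g v)) + 0)
    ≤⟨ +-mono-≤ IH (+-monoˡ-≤ 0 IH) ⟩
  2 ^ suc g                                                         ∎
  where
  open ≤-Reasoning
  IH : ∑[ v ∈ coinFlips L ] 𝟙 (allTrueFrom g v) ≤ 2 ^ g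
  IH = ∑𝟙-allTrueFrom≤ L g

∑𝟙-upTo-suc≤ : ∀ (E : ℕ → Bool) L → ¬ T (E L) → ∑[ ℓ ∈ upTo (suc L) ] 𝟙 (E ℓ) ≤ L
∑𝟙-upTo-suc≤ E L ¬EL = begin
  ∑[ ℓ ∈ upTo (suc L) ] 𝟙 (E ℓ)                         ≡⟨ cong (λ ls → ∑ ls (𝟙 ∘ E)) (upTo-∷ʳ L) ⟨
  ∑[ ℓ ∈ upTo L ∷ʳ L ] 𝟙 (E ℓ)                          ≡⟨ ∑-++ (𝟙 ∘ E) (upTo L) (L ∷ []) ⟩
  (∑[ ℓ ∈ upTo L ] 𝟙 (E ℓ)) + (𝟙 (E L) + 0)             ≤⟨ +-mono-≤ (∑𝟙≤length E (upTo L)) (+-monoˡ-≤ 0 EL≤0) ⟩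
  length (upTo L) + 0                                   ≡⟨ trans (+-identityʳ _) (length-upTo L) ⟩
  L                                                     ∎
  where
  open ≤-Reasoning
  EL≤0 : 𝟙 (E L) ≤ 0
  EL≤0 = 𝟙-mono {b = false} (λ EL → contradiction EL ¬EL)

tooManyLevels⇒topNonempty : ∀ {n} (p : Fin n → ℚ) L (ω : Outcome n L) →
  T (not (atMostLevels p L ω)) → T (nonempty (level p (coinsOf ω) L))
tooManyLevels⇒topNonempty p L ω tooMany = decidable-stable (T? _) λ topEmpty →
  toWitnessFalse tooMany (∑𝟙-upTo-suc≤ (λ ℓ → nonempty (level p (coinsOf ω) ℓ)) L topEmpty)

∧-∨-∧-elim : ∀ a b c d → T (a ∧ (b ∨ c ∧ d)) → ¬ T b → T c × T d
∧-∨-∧-elim false _     _     _     ()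
∧-∨-∧-elim true  true  _     _     _  ¬b = contradiction tt ¬b
∧-∨-∧-elim true  false false _     ()
∧-∨-∧-elim true  false true  false ()
∧-∨-∧-elim true  false true  true  _  _  = tt , tt

inLevel⇒coinsFrom : ∀ {n} (p : Fin n → ℚ) coins i {g} → (∀ ℓ → g ≤ ℓ → ¬ T (forced p i ℓ)) →
  ∀ {L} → T (level p coins L i) → ∀ {ℓ} → g ≤ ℓ → ℓ < L → T (coins i ℓ)
inLevel⇒coinsFrom p coins i unforced {suc L} inL g≤ℓ ℓ<1+L
  with ∧-∨-∧-elim _ _ _ _ inL (unforced L (≤-trans g≤ℓ (s≤s⁻¹ ℓ<1+L))) | m≤n⇒m<n∨m≡n (s≤s⁻¹ ℓ<1+L)
... | inPrev , _    | inj₁ ℓ<L  = inLevel⇒coinsFrom p coins i unforced inPrev g≤ℓ ℓ<L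
... | _      , coin | inj₂ refl = coin

coinsOf-lookup : ∀ {n L} (ω : Outcome n L) i {ℓ} (ℓ<L : ℓ < L) →
  coinsOf ω i ℓ ≡ lookup (lookup ω i) (fromℕ< ℓ<L)
coinsOf-lookup {L = L} ω i {ℓ} ℓ<L with ℓ <? L
... | yes ℓ<L′ = cong (λ lt → lookup (lookup ω i) (fromℕ< lt)) (<-irrelevant ℓ<L′ ℓ<L)
... | no  ℓ≮L  = contradiction ℓ<L ℓ≮L

allTrueFrom-intro : ∀ {L} (v : Vec Bool L) g →
  (∀ {ℓ} (ℓ<L : ℓ < L) → g ≤ ℓ → T (lookup v (fromℕ< ℓ<L))) → T (allTrueFrom g v)
allTrueFrom-intro []      g       _        = tt
allTrueFrom-intro (b ∷ v) zero    trueFrom = Equivalence.from T-∧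
  (trueFrom (s≤s z≤n) z≤n , allTrueFrom-intro v zero λ ℓ<L _ → trueFrom (s≤s ℓ<L) z≤n)
allTrueFrom-intro (b ∷ v) (suc g) trueFrom = allTrueFrom-intro v g λ ℓ<L g≤ℓ → trueFrom (s≤s ℓ<L) (s≤s g≤ℓ)

inLevel⇒allTrueFrom : ∀ {n} (p : Fin n → ℚ) i {g} → (∀ ℓ → g ≤ ℓ → ¬ T (forced p i ℓ)) →
  ∀ {L} (ω : Outcome n L) → T (level p (coinsOf ω) L i) → T (allTrueFrom g (lookup ω i))
inLevel⇒allTrueFrom p i {g} unforced ω inL = allTrueFrom-intro (lookup ω i) g λ ℓ<L g≤ℓ →
  subst T (coinsOf-lookup ω i ℓ<L) (inLevel⇒coinsFrom p (coinsOf ω) i unforced inL g≤ℓ ℓ<L)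

unfavourable≤ : ∀ {m} (p : Fin (suc m) → ℚ) (g : Fin (suc m) → ℕ) →
  (∀ i ℓ → g i ≤ ℓ → ¬ T (forced p i ℓ)) → ∀ L →
  ∑[ ω ∈ outcomes (suc m) L ] 𝟙 (not (atMostLevels p L ω)) ≤ (2 ^ L) ^ m * (∑[ i ∈ allFin (suc m) ] 2 ^ g i)
unfavourable≤ {m} p g unforced L = begin
  ∑[ ω ∈ Ω ] 𝟙 (not (atMostLevels p L ω))
    ≤⟨ ∑-mono-≤ (λ ω → 𝟙-mono (tooManyLevels⇒topNonempty p L ω)) Ω ⟩
  ∑[ ω ∈ Ω ] 𝟙 (nonempty (level p (coinsOf ω) L))
    ≤⟨ union-bound (λ ω i → level p (coinsOf ω) L i) items Ω ⟩
  ∑[ i ∈ items ] ∑[ ω ∈ Ω ] 𝟙 (level p (coinsOf ω) L i)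
    ≤⟨ ∑-mono-≤ (λ i → ∑-mono-≤ (λ ω → 𝟙-mono (inLevel⇒allTrueFrom p i (unforced i) ω)) Ω) items ⟩
  ∑[ i ∈ items ] ∑[ ω ∈ Ω ] 𝟙 (allTrueFrom (g i) (lookup ω i))
    ≡⟨ ∑-cong (λ i → ∑-allVecs-lookup (coinFlips L) m i (𝟙 ∘ allTrueFrom (g i))) items ⟩
  ∑[ i ∈ items ] length (coinFlips L) ^ m * (∑[ v ∈ coinFlips L ] 𝟙 (allTrueFrom (g i) v))
    ≤⟨ ∑-mono-≤ (λ i → *-monoʳ-≤ (length (coinFlips L) ^ m) (∑𝟙-allTrueFrom≤ L (g i))) items ⟩
  ∑[ i ∈ items ] length (coinFlips L) ^ m * 2 ^ g i
    ≡⟨ ∑-*ˡ (length (coinFlips L) ^ m) (λ i → 2 ^ g i) items ⟩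
  length (coinFlips L) ^ m * (∑[ i ∈ items ] 2 ^ g i)
    ≡⟨ cong (λ k → k ^ m * (∑[ i ∈ items ] 2 ^ g i)) (length-allVecs _ L) ⟩
  (2 ^ L) ^ m * (∑[ i ∈ items ] 2 ^ g i)
    ∎
  where
  open ≤-Reasoning
  Ω = outcomes (suc m) L
  items = allFin (suc m)

-- The normal form of ℕ→ℚ m = + m / 1, which normalisation only reaches for closed m.
ℕ→ℚ′ : ℕ → ℚ
ℕ→ℚ′ m = ℚ.mkℚ (ℤ.+ m) 0 (Coprime-sym (1-coprimeTo m))

ℕ→ℚ≡ℕ→ℚ′ : ∀ m → ℕ→ℚ m ≡ ℕ→ℚ′ m
ℕ→ℚ≡ℕ→ℚ′ m = ℚ.↥p/↧p≡p (ℕ→ℚ′ m)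

ℕ→ℚ-mono-≤ : ∀ {a b} → a ≤ b → ℕ→ℚ a ≤ℚ ℕ→ℚ b
ℕ→ℚ-mono-≤ {a} {b} a≤b rewrite ℕ→ℚ≡ℕ→ℚ′ a | ℕ→ℚ≡ℕ→ℚ′ b =
  ℚ.*≤* (subst₂ ℤ._≤_ (sym (ℤ.*-identityʳ (ℤ.+ a))) (sym (ℤ.*-identityʳ (ℤ.+ b))) (+≤+ a≤b))

ℕ→ℚ-cancel-≤ : ∀ {a b} → ℕ→ℚ a ≤ℚ ℕ→ℚ b → a ≤ b
ℕ→ℚ-cancel-≤ {a} {b} a≤b rewrite ℕ→ℚ≡ℕ→ℚ′ a | ℕ→ℚ≡ℕ→ℚ′ b
  with subst₂ ℤ._≤_ (ℤ.*-identityʳ (ℤ.+ a)) (ℤ.*-identityʳ (ℤ.+ b)) (ℚ.drop-*≤* a≤b)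
... | +≤+ a≤b′ = a≤b′

ℕ→ℚ-+ : ∀ a b → ℕ→ℚ (a + b) ≡ ℕ→ℚ a ℚ.+ ℕ→ℚ b
ℕ→ℚ-+ a b rewrite ℕ→ℚ≡ℕ→ℚ′ a | ℕ→ℚ≡ℕ→ℚ′ b | ℕ→ℚ≡ℕ→ℚ′ (a + b) =
  ℚ.toℚᵘ-injective (ℚᵘ.≃-trans homo (ℚᵘ.≃-sym (ℚ.toℚᵘ-homo-+ (ℕ→ℚ′ a) (ℕ→ℚ′ b))))
  where
  homo : ℚᵘ.mkℚᵘ (ℤ.+ (a + b)) 0 ℚᵘ.≃ ℚᵘ.mkℚᵘ (ℤ.+ a) 0 ℚᵘ.+ ℚᵘ.mkℚᵘ (ℤ.+ b) 0
  homo = ℚᵘ.*≡* (trans (ℤ.*-identityʳ _)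
           (sym (trans (ℤ.*-identityʳ _) (cong₂ ℤ._+_ (ℤ.*-identityʳ (ℤ.+ a)) (ℤ.*-identityʳ (ℤ.+ b))))))

least2^> : ∀ {x} → 0ℚ ≤ℚ x → ∀ N → ¬ ℕ→ℚ (2 ^ N) ≤ℚ x →
  ∃[ g ] ¬ ℕ→ℚ (2 ^ g) ≤ℚ x × ℕ→ℚ (2 ^ g) ≤ℚ (x ℚ.+ x) ℚ.+ 1ℚ
least2^> 0≤x zero    1≰x = 0 , 1≰x , ℚ.+-monoˡ-≤ 1ℚ (ℚ.+-mono-≤ 0≤x 0≤x)
least2^> {x} 0≤x (suc N) 2^[1+N]≰x with ℕ→ℚ (2 ^ N) ℚ.≤? x
... | no  2^N≰x = least2^> 0≤x N 2^N≰x
... | yes 2^N≤x = suc N , 2^[1+N]≰x , (begin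
  ℕ→ℚ (2 ^ suc N)                ≡⟨ cong (λ k → ℕ→ℚ (2 ^ N + k)) (+-identityʳ (2 ^ N)) ⟩
  ℕ→ℚ (2 ^ N + 2 ^ N)            ≡⟨ ℕ→ℚ-+ (2 ^ N) (2 ^ N) ⟩
  ℕ→ℚ (2 ^ N) ℚ.+ ℕ→ℚ (2 ^ N)    ≤⟨ ℚ.+-mono-≤ 2^N≤x 2^N≤x ⟩
  x ℚ.+ x                        ≡⟨ ℚ.+-identityʳ (x ℚ.+ x) ⟨
  (x ℚ.+ x) ℚ.+ 0ℚ               ≤⟨ ℚ.+-monoʳ-≤ (x ℚ.+ x) (ℕ→ℚ-mono-≤ {0} {1} z≤n) ⟩
  (x ℚ.+ x) ℚ.+ 1ℚ               ∎)
  where open ℚ.≤-Reasoning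

2^-exceeds-mono : ∀ {x g ℓ} → ¬ ℕ→ℚ (2 ^ g) ≤ℚ x → g ≤ ℓ → ¬ ℕ→ℚ (2 ^ ℓ) ≤ℚ x
2^-exceeds-mono 2^g≰x g≤ℓ 2^ℓ≤x = 2^g≰x (ℚ.≤-trans (ℕ→ℚ-mono-≤ (^-monoʳ-≤ 2 g≤ℓ)) 2^ℓ≤x)

ℚ-almostCommutativeRing : AlmostCommutativeRing 0ℓ 0ℓ
ℚ-almostCommutativeRing = fromCommutativeRing ℚ.+-*-commutativeRing (λ _ → nothing)

-- The fold of sumℚ, so that sumℚ p is ∑ℚ (allFin n) p definitionally.
∑ℚ : {A : Set} → List A → (A → ℚ) → ℚ
∑ℚ xs f = foldr (λ x acc → f x ℚ.+ acc) 0ℚ xs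

module _ {A : Set} where

  ℕ→ℚ-∑-≤ : ∀ (f : A → ℕ) (φ : A → ℚ) xs → (∀ x → ℕ→ℚ (f x) ≤ℚ φ x) → ℕ→ℚ (∑ xs f) ≤ℚ ∑ℚ xs φ
  ℕ→ℚ-∑-≤ f φ []       _    = ℚ.≤-refl
  ℕ→ℚ-∑-≤ f φ (x ∷ xs) f≤φ = begin
    ℕ→ℚ (f x + ∑ xs f)           ≡⟨ ℕ→ℚ-+ (f x) (∑ xs f) ⟩
    ℕ→ℚ (f x) ℚ.+ ℕ→ℚ (∑ xs f)   ≤⟨ ℚ.+-mono-≤ (f≤φ x) (ℕ→ℚ-∑-≤ f φ xs f≤φ) ⟩
    φ x ℚ.+ ∑ℚ xs φ              ∎
    where open ℚ.≤-Reasoning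

  ∑ℚ-affine : ∀ c (φ : A → ℚ) xs →
    ∑ℚ xs (λ x → (c ℚ.* φ x ℚ.+ c ℚ.* φ x) ℚ.+ 1ℚ)
      ≡ (c ℚ.* ∑ℚ xs φ ℚ.+ c ℚ.* ∑ℚ xs φ) ℚ.+ ℕ→ℚ (length xs)
  ∑ℚ-affine c φ [] rewrite ℚ.*-zeroʳ c = refl
  ∑ℚ-affine c φ (x ∷ xs) = begin
    (c ℚ.* φ x ℚ.+ c ℚ.* φ x ℚ.+ 1ℚ) ℚ.+ ∑ℚ xs (λ x → (c ℚ.* φ x ℚ.+ c ℚ.* φ x) ℚ.+ 1ℚ)
      ≡⟨ cong (c ℚ.* φ x ℚ.+ c ℚ.* φ x ℚ.+ 1ℚ ℚ.+_) (∑ℚ-affine c φ xs) ⟩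
    (c ℚ.* φ x ℚ.+ c ℚ.* φ x ℚ.+ 1ℚ) ℚ.+ ((c ℚ.* S ℚ.+ c ℚ.* S) ℚ.+ ℕ→ℚ (length xs))
      ≡⟨ regroup c (φ x) S (ℕ→ℚ (length xs)) ⟩
    (c ℚ.* (φ x ℚ.+ S) ℚ.+ c ℚ.* (φ x ℚ.+ S)) ℚ.+ (1ℚ ℚ.+ ℕ→ℚ (length xs))
      ≡⟨ cong (c ℚ.* (φ x ℚ.+ S) ℚ.+ c ℚ.* (φ x ℚ.+ S) ℚ.+_) (ℕ→ℚ-+ 1 (length xs)) ⟨
    (c ℚ.* (φ x ℚ.+ S) ℚ.+ c ℚ.* (φ x ℚ.+ S)) ℚ.+ ℕ→ℚ (length (x ∷ xs))
      ∎
    where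
    open ≡-Reasoning
    S = ∑ℚ xs φ
    regroup : ∀ c a s l → (c ℚ.* a ℚ.+ c ℚ.* a ℚ.+ 1ℚ) ℚ.+ ((c ℚ.* s ℚ.+ c ℚ.* s) ℚ.+ l)
                          ≡ (c ℚ.* (a ℚ.+ s) ℚ.+ c ℚ.* (a ℚ.+ s)) ℚ.+ (1ℚ ℚ.+ l)
    regroup = solve-∀ ℚ-almostCommutativeRing

n<2^n : ∀ n → n < 2 ^ n
n<2^n zero    = s≤s z≤n
n<2^n (suc n) = +-mono-≤-< (m^n>0 2 n) (<-≤-trans (n<2^n n) (m≤m+n (2 ^ n) 0))

module _ {n} (p : Fin n → ℚ) (p∈[0,1] : ∀ i → (0ℚ ≤ℚ p i) × (p i ≤ℚ 1ℚ)) where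
  private
    N : ℚ
    N = ℕ→ℚ n

    instance
      N-nonNeg : ℚ.NonNegative N
      N-nonNeg = ℚ.nonNegative (ℕ→ℚ-mono-≤ {0} {n} z≤n)

    0≤Np : ∀ i → 0ℚ ≤ℚ N ℚ.* p i
    0≤Np i = subst (_≤ℚ N ℚ.* p i) (ℚ.*-zeroʳ N) (ℚ.*-monoˡ-≤-nonNeg N (proj₁ (p∈[0,1] i)))

    2^n≰Np : ∀ i → ¬ ℕ→ℚ (2 ^ n) ≤ℚ N ℚ.* p i
    2^n≰Np i 2^n≤Np = <⇒≱ (n<2^n n) (ℕ→ℚ-cancel-≤ (ℚ.≤-trans 2^n≤Np Np≤N))
      where
      Np≤N : N ℚ.* p i ≤ℚ N
      Np≤N = subst (N ℚ.* p i ≤ℚ_) (ℚ.*-identityʳ N) (ℚ.*-monoˡ-≤-nonNeg N (proj₂ (p∈[0,1] i)))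

    least : ∀ i → ∃[ g ] ¬ ℕ→ℚ (2 ^ g) ≤ℚ N ℚ.* p i
                       × ℕ→ℚ (2 ^ g) ≤ℚ (N ℚ.* p i ℚ.+ N ℚ.* p i) ℚ.+ 1ℚ
    least i = least2^> (0≤Np i) n (2^n≰Np i)

  firstUnforced : Fin n → ℕ
  firstUnforced i = proj₁ (least i)

  unforcedFrom : ∀ i ℓ → firstUnforced i ≤ ℓ → ¬ T (forced p i ℓ)
  unforcedFrom i ℓ g≤ℓ forcedℓ = 2^-exceeds-mono (proj₁ (proj₂ (least i))) g≤ℓ (toWitness forcedℓ)

  ∑2^firstUnforced≤ : sumℚ p ≡ 1ℚ → ∑[ i ∈ allFin n ] 2 ^ firstUnforced i ≤ (n + n) + n
  ∑2^firstUnforced≤ Σp≡1 = ℕ→ℚ-cancel-≤ (begin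
    ℕ→ℚ (∑[ i ∈ allFin n ] 2 ^ firstUnforced i)
      ≤⟨ ℕ→ℚ-∑-≤ _ _ (allFin n) (λ i → proj₂ (proj₂ (least i))) ⟩
    ∑ℚ (allFin n) (λ i → (N ℚ.* p i ℚ.+ N ℚ.* p i) ℚ.+ 1ℚ)
      ≡⟨ ∑ℚ-affine N p (allFin n) ⟩
    (N ℚ.* sumℚ p ℚ.+ N ℚ.* sumℚ p) ℚ.+ ℕ→ℚ (length (allFin n))
      ≡⟨ cong₂ (λ s k → (N ℚ.* s ℚ.+ N ℚ.* s) ℚ.+ ℕ→ℚ k) Σp≡1 (length-tabulate {n = n} id) ⟩
    (N ℚ.* 1ℚ ℚ.+ N ℚ.* 1ℚ) ℚ.+ N
      ≡⟨ cong (λ a → (a ℚ.+ a) ℚ.+ N) (ℚ.*-identityʳ N) ⟩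
    (N ℚ.+ N) ℚ.+ N
      ≡⟨ trans (ℕ→ℚ-+ (n + n) n) (cong (ℚ._+ N) (ℕ→ℚ-+ n n)) ⟨
    ℕ→ℚ ((n + n) + n)
      ∎)
    where open ℚ.≤-Reasoning

n<2^[1+⌊log₂n⌋] : ∀ n → n < 2 ^ suc ⌊log₂ n ⌋
n<2^[1+⌊log₂n⌋] n = ≰⇒> λ 2^[1+⌊log₂n⌋]≤n →
  n≮n ⌊log₂ n ⌋ (subst (_≤ ⌊log₂ n ⌋) (⌊log₂[2^n]⌋≡n (suc ⌊log₂ n ⌋)) (⌊log₂⌋-mono-≤ 2^[1+⌊log₂n⌋]≤n))

100·3n≤2^bound : ∀ n → 100 * ((n + n) + n) ≤ 2 ^ bound n
100·3n≤2^bound n = begin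
  100 * ((n + n) + n)                     ≤⟨ *-monoʳ-≤ 100 (+-mono-≤ (+-mono-≤ n≤2M n≤2M) n≤2M) ⟩
  100 * ((2 * M + 2 * M) + 2 * M)         ≡⟨ six-hundred M ⟩
  600 * M                                 ≤⟨ *-monoˡ-≤ M (toWitness {a? = 600 ≤? 1024} tt) ⟩
  2 ^ 10 * M                              ≡⟨ ^-distribˡ-+-* 2 10 ⌊log₂ n ⌋ ⟨
  2 ^ bound n                             ∎
  where
  open ≤-Reasoning
  M = 2 ^ ⌊log₂ n ⌋
  n≤2M : n ≤ 2 * M
  n≤2M = <⇒≤ (n<2^[1+⌊log₂n⌋] n)
  six-hundred : ∀ M → 100 * ((2 * M + 2 * M) + 2 * M) ≡ 600 * M
  six-hundred = ℕ-solve-∀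

99%-good : ∀ {good bad total} → good + bad ≡ total → 100 * bad ≤ total → 99 * total ≤ 100 * good
99%-good {good} {bad} {total} good+bad≡total 100·bad≤total = +-cancelʳ-≤ (100 * bad) (99 * total) (100 * good) (begin
  99 * total + 100 * bad      ≤⟨ +-monoʳ-≤ (99 * total) 100·bad≤total ⟩
  99 * total + total          ≡⟨ +-comm (99 * total) total ⟩
  100 * total                 ≡⟨ cong (100 *_) good+bad≡total ⟨
  100 * (good + bad)          ≡⟨ *-distribˡ-+ 100 good bad ⟩
  100 * good + 100 * bad      ∎)
  where open ≤-Reasoning

length-outcomes : ∀ n L → length (outcomes n L) ≡ (2 ^ L) ^ n
length-outcomes n L = trans (length-allVecs (coinFlips L) n) (cong (_^ n) (length-allVecs _ L))

mainTheorem15 : (n : ℕ) (p : Fin n → ℚ) →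
    (∀ i → (0ℚ ≤ℚ p i) × (p i ≤ℚ 1ℚ)) → sumℚ p ≡ 1ℚ →
    99 * length (outcomes n (bound n)) ≤ 100 * favourable p (bound n)
mainTheorem15 zero      p _       ()
mainTheorem15 n@(suc m) p p∈[0,1] Σp≡1 =
  99%-good {bad = bad} (length-filterᵇ+∑𝟙-not (atMostLevels p L) Ω) (begin
    100 * bad                     ≤⟨ *-monoʳ-≤ 100 (unfavourable≤ p g (unforcedFrom p p∈[0,1]) L) ⟩
    100 * ((2 ^ L) ^ m * S)       ≡⟨ *-CS.x∙yz≈y∙xz 100 ((2 ^ L) ^ m) S ⟩
    (2 ^ L) ^ m * (100 * S)       ≤⟨ *-monoʳ-≤ ((2 ^ L) ^ m) 100·S≤2^L ⟩
    (2 ^ L) ^ m * 2 ^ L           ≡⟨ trans (length-outcomes n L) (*-comm (2 ^ L) ((2 ^ L) ^ m)) ⟨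
    length Ω                      ∎)
  where
  open ≤-Reasoning
  L = bound n
  Ω = outcomes n L
  bad = ∑[ ω ∈ Ω ] 𝟙 (not (atMostLevels p L ω))
  g = firstUnforced p p∈[0,1]
  S = ∑[ i ∈ allFin n ] 2 ^ g i
  100·S≤2^L : 100 * S ≤ 2 ^ L
  100·S≤2^L = ≤-trans (*-monoʳ-≤ 100 (∑2^firstUnforced≤ p p∈[0,1] Σp≡1)) (100·3n≤2^bound n)
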